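{- Let $\mathcal{F} \subseteq \omega^\omega$ be an eventually different family, let $g \in \omega^\omega$, and let $\mathcal{F}_1 \subseteq \mathcal{F}$ be infinite. Assume that for every $f \in \mathcal{F}_1$ the set $\{n<\omega : f(n)=g(n)\}$ is infinite. Then $g \in \operatorname{cov}^+(\mathcal{F})$.
   Context: Functions $f,g\in\omega^\omega$ are eventually different if $\{n<\omega: f(n)=g(n)\}$ is finite; a family $\mathcal{F}\subseteq\omega^\omega$ is eventually different (e.d.) if any two distinct members are eventually different. For an e.d. family $\mathcal{F}$, $\operatorname{cov}(\mathcal{F})$ is the set of all $g\in\omega^\omega$ such that there are a finite $\mathcal{F}_0\subseteq\mathcal{F}$ and $N<\omega$ with: for all $n\ge N$ there is $f\in\mathcal{F}_0$ with $f(n)=g(n)$. Further $\operatorname{cov}^+(\mathcal{F}) := \omega^\omega\setminus\operatorname{cov}(\mathcal{F})$. -}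

module Defs where

open import Data.Nat using (ℕ; _≥_)
open import Data.Product using (Σ; ∃; _×_)
open import Data.List using (List)
open import Data.List.Relation.Unary.All using (All)
open import Data.List.Relation.Unary.Any using (Any)
open import Relation.Nullary using (¬_)
open import Relation.Binary.PropositionalEquality using (_≡_; _≗_)

-- ω^ω : functions ℕ → ℕ; two functions are "the same" when pointwise equal.
Baire : Set
Baire = ℕ → ℕ

Family : Set₁
Family = Baire → Set

FiniteSetℕ : (ℕ → Set) → Set
FiniteSetℕ P = ∃ λ N → ∀ n → n ≥ N → ¬ P n

InfiniteSetℕ : (ℕ → Set) → Set
InfiniteSetℕ P = ¬ FiniteSetℕ P

FiniteFamily : Family → Set
FiniteFamily F = ∃ λ (L : List Baire) → ∀ f → F f → Any (λ h → f ≗ h) L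

InfiniteFamily : Family → Set
InfiniteFamily F = ¬ FiniteFamily F

_⊆F_ : Family → Family → Set
F₁ ⊆F F = ∀ f → F₁ f → F f

EventuallyDifferent : Baire → Baire → Set
EventuallyDifferent f g = FiniteSetℕ (λ n → f n ≡ g n)

EDFamily : Family → Set
EDFamily F = ∀ f g → F f → F g → ¬ (f ≗ g) → EventuallyDifferent f g

_∈cov_ : Baire → Family → Set
g ∈cov F = ∃ λ (F₀ : List Baire) → All F F₀ ×
  (∃ λ N → ∀ n → n ≥ N → Any (λ f → f n ≡ g n) F₀)

_∈cov⁺_ : Baire → Family → Set
g ∈cov⁺ F = ¬ (g ∈cov F)

-- Suppose g were covered from N on by a finite F₀ ⊆ F. A member f of F₁ that
-- is eventually different from every member of F₀ would agree with g only
-- below some bound, so no f ∈ F₁ can be distinct from all of F₀. Distinct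
-- members of F₀ disagree everywhere beyond some M, so the value at M singles
-- out the member of F₀ equal to f, and F₀ enumerates the infinite family F₁.
-- Constructively "f ≗ h or not" is undecidable; the argument is run in the
-- double-negation monad, which suffices as the goal is ⊥.
module Submission where

open import Defs
open import Data.Nat using (ℕ; _≥_; _⊔_; _≟_)
open import Data.Nat.Properties using (≤-refl; ≤-trans; m≤m⊔n; m≤n⊔m)
open import Data.Product using (∃; _×_; _,_)
open import Data.List using (List; []; _∷_)
open import Data.List.Relation.Unary.All as All using (All; []; _∷_)
open import Data.List.Relation.Unary.All.Properties using (¬Any⇒All¬)
open import Data.List.Relation.Unary.Any as Any using (Any; any?)
open import Data.List.Membership.Propositional using (_∈_; find; lose)
open import Relation.Nullary using (¬_; Dec; yes; no)
open import Relation.Nullary.Negation using (¬¬-map; ¬¬-Monad; contradiction)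
open import Relation.Nullary.Decidable using (decidable-stable; ¬¬-excluded-middle)
open import Relation.Binary.PropositionalEquality using (_≡_; _≗_; sym; trans)

Eventually : (ℕ → Set) → Set
Eventually P = ∃ λ N → ∀ n → n ≥ N → P n

eventually-map : {P Q : ℕ → Set} → (∀ {n} → P n → Q n) → Eventually P → Eventually Q
eventually-map f (N , p) = N , λ n n≥N → f (p n n≥N)

eventually-× : {P Q : ℕ → Set} → Eventually P → Eventually Q →
               Eventually (λ n → P n × Q n)
eventually-× (M , p) (N , q) = M ⊔ N , λ n n≥M⊔N →
  p n (≤-trans (m≤m⊔n M N) n≥M⊔N) , q n (≤-trans (m≤n⊔m M N) n≥M⊔N)

eventually-All : {A : Set} {P : A → ℕ → Set} {xs : List A} →
                 All (λ x → Eventually (P x)) xs → Eventually (λ n → All (λ x → P x n) xs)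
eventually-All []         = 0 , λ _ _ → []
eventually-All (ev ∷ evs) =
  eventually-map (λ (p , ps) → p ∷ ps) (eventually-× ev (eventually-All evs))

¬¬-All : {A : Set} {P : A → Set} {xs : List A} →
         All (λ x → ¬ ¬ P x) xs → ¬ ¬ All P xs
¬¬-All = All.sequenceM _ ¬¬-Monad

CoversFrom : List Baire → Baire → ℕ → Set
CoversFrom L g n = Any (λ h → h n ≡ g n) L

SeparatedAt : List Baire → ℕ → Set
SeparatedAt L M = All (λ h → All (λ h′ → h M ≡ h′ M → h ≗ h′) L) L

eventuallyDifferent-from-covered : ∀ {f g L} →
  All (EventuallyDifferent f) L → Eventually (CoversFrom L g) →
  EventuallyDifferent f g
eventuallyDifferent-from-covered differs covers =
  eventually-map (λ (f≢L , L∋g) f≡g →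
                    All.lookupWith (λ fn≢hn hn≡gn → fn≢hn (trans f≡g (sym hn≡gn))) f≢L L∋g)
                 (eventually-× (eventually-All differs) covers)

module _ {F : Family} (ed : EDFamily F) where

  ¬¬-eventually-agreement⇒≗ : ∀ {h h′} → F h → F h′ →
    ¬ ¬ Eventually (λ n → h n ≡ h′ n → h ≗ h′)
  ¬¬-eventually-agreement⇒≗ {h} {h′} Fh Fh′ = ¬¬-map separate ¬¬-excluded-middle
    where
    separate : Dec (h ≗ h′) → Eventually (λ n → h n ≡ h′ n → h ≗ h′)
    separate (yes h≗h′) = 0 , λ _ _ _ → h≗h′
    separate (no h≉h′)  =
      eventually-map (λ hn≢h′n hn≡h′n → contradiction hn≡h′n hn≢h′n) (ed h h′ Fh Fh′ h≉h′)

  ¬¬-separated : ∀ {L} → All F L → ¬ ¬ ∃ (SeparatedAt L)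
  ¬¬-separated {L} L⊆F =
    ¬¬-map (λ (M , sep) → M , sep M ≤-refl)
      (¬¬-map eventually-All (¬¬-All (All.map separatedFrom L⊆F)))
    where
    separatedFrom : ∀ {h} → F h →
      ¬ ¬ Eventually (λ n → All (λ h′ → h n ≡ h′ n → h ≗ h′) L)
    separatedFrom Fh =
      ¬¬-map eventually-All (¬¬-All (All.map (¬¬-eventually-agreement⇒≗ Fh) L⊆F))

  ¬¬-∈-cover : ∀ {f g L} → F f → All F L → Eventually (CoversFrom L g) →
    InfiniteSetℕ (λ n → f n ≡ g n) → ¬ ¬ Any (f ≗_) L
  ¬¬-∈-cover {f} {L = L} Ff L⊆F covers agreeInfinitely f∉L =
    agreeInfinitely (eventuallyDifferent-from-covered differs covers)
    where
    differs : All (EventuallyDifferent f) L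
    differs = All.zipWith (λ (Fh , f≉h) → ed f _ Ff Fh f≉h) (L⊆F , ¬Any⇒All¬ L f∉L)

≗-stable : {f h : Baire} → ¬ ¬ (f ≗ h) → f ≗ h
≗-stable {f} {h} ¬¬f≗h n = decidable-stable (f n ≟ h n) (¬¬-map (λ f≗h → f≗h n) ¬¬f≗h)

agreement-at⇒≗ : ∀ {f h L M} → SeparatedAt L M → h ∈ L → f M ≡ h M →
  Any (f ≗_) L → f ≗ h
agreement-at⇒≗ {M = M} sep h∈L fM≡hM f∈L n =
  let (h′ , h′∈L , f≗h′) = find f∈L
  in trans (f≗h′ n) (All.lookup (All.lookup sep h′∈L) h∈L (trans (sym (f≗h′ M)) fM≡hM) n)

∈-stable : ∀ {f L M} → SeparatedAt L M → ¬ ¬ Any (f ≗_) L → Any (f ≗_) L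
∈-stable {f} {L} {M} sep ¬¬f∈L with any? (λ h → f M ≟ h M) L
... | no fM∉L  = contradiction (λ f∈L → fM∉L (Any.map (λ f≗h → f≗h M) f∈L)) ¬¬f∈L
... | yes fM∈L =
  let (h , h∈L , fM≡hM) = find fM∈L
  in lose h∈L (≗-stable (¬¬-map (agreement-at⇒≗ sep h∈L fM≡hM) ¬¬f∈L))

proposition2p5 : (F : Family) → EDFamily F → (g : Baire) → (F₁ : Family) →
    F₁ ⊆F F → InfiniteFamily F₁ →
    (∀ f → F₁ f → InfiniteSetℕ (λ n → f n ≡ g n)) →
    g ∈cov⁺ F
proposition2p5 F ed g F₁ F₁⊆F F₁-infinite agree (F₀ , F₀⊆F , covers) =
  ¬¬-separated ed F₀⊆F λ (M , sep) →
    F₁-infinite (F₀ , λ f F₁f →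
      ∈-stable sep (¬¬-∈-cover ed (F₁⊆F f F₁f) F₀⊆F covers (agree f F₁f)))
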